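{- Let $\mathcal{C}$ be any permutation class and let $\pi$ be any permutation that can be generated by the $\mathcal{C}$-machine. Then there is exactly one generation sequence for $\pi$ that satisfies both rules (U1) and (U2).
   Context: A permutation class is a set of permutations closed downward under pattern containment (where $\pi$ contains $\sigma$ if $\pi$ has a subsequence order isomorphic to $\sigma$). For a permutation class $\mathcal{C}$, the $\mathcal{C}$-machine has an input, initially $1,2,\dots,n$, a container, initially empty, holding a sequence of distinct integers, and an output, initially empty. The allowed operations are: (bypass) remove the next input entry and append it to the end of the output; (push) remove the next input entry and insert it at some position in the container, provided the container's contents remain order isomorphic to a permutation in $\mathcal{C}$; (pop) remove the leftmost container entry and append it to the end of the output. A generation sequence for $\pi$ is a sequence of such operations (recording, for each push, the position at which the entry is inserted) that starts from input $1,\dots,n$ with empty container and output and ends with empty input and container and output $\pi$. An entry $\pi(j)$ is a left-to-right maximum if $\pi(j)>\pi(i)$ for all $i<j$. The rules are: (U1) one pops from the container whenever possible, i.e., whenever the leftmost entry of the container is the next entry of $\pi$ to be placed in the output, the next operation performed is a pop; (U2) every left-to-right maximum of $\pi$ is placed in the output by a bypass. -}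

module Defs where

open import Data.Nat using (ℕ; zero; suc; _<_; _≤_)
open import Data.List using (List; []; _∷_; _++_; [_]; length; map; upTo; take; drop; lookup)
open import Data.List.Relation.Binary.Permutation.Propositional using (_↭_)
open import Data.List.Relation.Binary.Sublist.Propositional using (_⊆_)
open import Data.Fin as Fin using (Fin; toℕ)
open import Data.Product using (Σ; _×_; _,_; ∃)
open import Data.Sum using (_⊎_)
open import Data.Unit using (⊤)
open import Relation.Binary.PropositionalEquality using (_≡_)
open import Function.Bundles using (_⇔_)

oneTo : ℕ → List ℕ
oneTo n = map suc (upTo n)

IsPerm : List ℕ → Set
IsPerm π = π ↭ oneTo (length π)

data OrdIso : List ℕ → List ℕ → Set where
  []  : OrdIso [] []
  _∷_ : ∀ {x y xs ys} →
        (∀ (i : Fin (length xs)) (j : Fin (length ys)) → toℕ i ≡ toℕ j →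
           ((x < lookup xs i) ⇔ (y < lookup ys j)) ×
           ((lookup xs i < x) ⇔ (lookup ys j < y))) →
        OrdIso xs ys → OrdIso (x ∷ xs) (y ∷ ys)

Contains : List ℕ → List ℕ → Set
Contains π σ = Σ (List ℕ) λ τ → (τ ⊆ π) × OrdIso τ σ

record PermClass : Set₁ where
  field
    member : List ℕ → Set
    isPerm : ∀ π → member π → IsPerm π
    closed : ∀ π σ → member π → IsPerm σ → Contains π σ → member σ
open PermClass public

-- the container may hold xs iff xs is order isomorphic to a permutation of C
Allowed : PermClass → List ℕ → Set
Allowed C xs = Σ (List ℕ) λ σ → member C σ × OrdIso xs σ

-- operations; push k records the (0-based) position of insertion in the container
data Op : Set where
  bypass : Op
  push   : ℕ → Op
  pop    : Op

insertAt : ℕ → ℕ → List ℕ → List ℕ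
insertAt k x c = take k c ++ (x ∷ drop k c)

record State : Set where
  constructor ⟨_,_,_⟩
  field
    input     : List ℕ
    container : List ℕ
    output    : List ℕ
open State public

data Step (C : PermClass) : Op → State → State → Set where
  bypassStep : ∀ {x inp c out} →
    Step C bypass ⟨ x ∷ inp , c , out ⟩ ⟨ inp , c , out ++ [ x ] ⟩
  pushStep : ∀ {k x inp c out} → k ≤ length c → Allowed C (insertAt k x c) →
    Step C (push k) ⟨ x ∷ inp , c , out ⟩ ⟨ inp , insertAt k x c , out ⟩
  popStep : ∀ {x inp c out} →
    Step C pop ⟨ inp , x ∷ c , out ⟩ ⟨ inp , c , out ++ [ x ] ⟩

data Run (C : PermClass) (P : Op → State → Set) : List Op → State → State → Set where
  done : ∀ {s} → Run C P [] s s
  step : ∀ {op ops s s' t} → Step C op s s' → P op s → Run C P ops s' t →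
         Run C P (op ∷ ops) s t

initial : List ℕ → State
initial π = ⟨ oneTo (length π) , [] , [] ⟩

final : List ℕ → State
final π = ⟨ [] , [] , π ⟩

NoCondition : Op → State → Set
NoCondition _ _ = ⊤

GenSeq : PermClass → List ℕ → List Op → Set
GenSeq C π ops = Run C NoCondition ops (initial π) (final π)

Generable : PermClass → List ℕ → Set
Generable C π = ∃ λ ops → GenSeq C π ops

LRMaxAt : (π : List ℕ) → Fin (length π) → Set
LRMaxAt π j = ∀ (i : Fin (length π)) → i Fin.< j → lookup π i < lookup π j

-- (U1): if the leftmost container entry is the next entry of π to be output,
-- the next operation is a pop
U1 : List ℕ → Op → State → Set
U1 π op s = ∀ (j : Fin (length π)) (x : ℕ) (c : List ℕ) →
  toℕ j ≡ length (output s) → container s ≡ x ∷ c → lookup π j ≡ x → op ≡ pop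

-- (U2): an operation placing a left-to-right maximum of π into the output is a bypass
U2 : List ℕ → Op → State → Set
U2 π op s = ∀ (j : Fin (length π)) →
  toℕ j ≡ length (output s) → LRMaxAt π j → (op ≡ bypass ⊎ op ≡ pop) → op ≡ bypass

U1U2 : List ℕ → Op → State → Set
U1U2 π op s = U1 π op s × U2 π op s

GoodGenSeq : PermClass → List ℕ → List Op → Set
GoodGenSeq C π ops = Run C (U1U2 π) ops (initial π) (final π)

-- Along any run ending with output π, the output is a prefix of π and the
-- container a subsequence of the rest of π. Hence two runs obeying (U1) and (U2)
-- cannot diverge: what remains of π determines every push position, (U1) forces a
-- pop whenever one is possible, and pushing an input that the other run bypasses
-- would leave a left-to-right maximum at the front of the container, where (U1)
-- and (U2) conflict.
-- For existence, read 1, 2, … in turn: pop while the next entry of π is in the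
-- container, bypass the entry just read if it is the next entry of π, and push it
-- otherwise, so that the container always holds the read entries not yet output,
-- in π-order. Right after m + 1 is pushed this is a sublist of the container of
-- any generation sequence at the same moment, hence allowed since C is closed
-- under patterns.
module Submission where

open import Defs
open import Data.Nat using (ℕ; zero; suc; _+_; _<_; _≤_; _≤?_; _<?_; z≤n; s≤s)
open import Data.Nat.Properties
open import Data.List using (List; []; _∷_; _++_; [_]; length; map; take; drop; lookup; filter)
open import Data.List.Properties using (map-upTo; ∷-injectiveˡ; ∷-injectiveʳ; map-cong-local; map-∘; length-map; filter-none; ++-cancelˡ; ++-assoc; ++-identityʳ; take++drop≡id; filter-accept; filter-reject)
open import Data.List.Membership.Propositional using (_∈_; _∉_)
open import Data.List.Membership.Propositional.Properties using (∈-map⁺; ∈-map⁻; ∈-upTo⁺; ∈-upTo⁻; ∈-++⁺ˡ; ∈-++⁺ʳ; ∈-++⁻; ∈-filter⁻; ∈-filter⁺)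
open import Data.List.Relation.Binary.Permutation.Propositional using (_↭_; ↭-sym; ↭-trans; ↭-reflexive; ↭⇒↭ₛ; module PermutationReasoning)
open import Data.List.Relation.Binary.Permutation.Propositional.Properties using (∈-resp-↭; All-resp-↭; shift; ↭-length; filter-↭; map⁺)
open import Data.List.Relation.Binary.Sublist.Propositional using (_⊆_; []; _∷_; _∷ʳ_; ⊆-refl; ⊆-trans; ⊆-antisym; minimum)
open import Data.List.Relation.Binary.Sublist.Propositional.Properties using (All-resp-⊆; Any-resp-⊆; filter-⊆; filter⁺; length-mono-≤; to-≋; ++⁺; ++⁺ˡ)
open import Data.List.Relation.Unary.All as All using (All; []; _∷_)
import Data.List.Relation.Unary.All.Properties as AllP
open import Data.List.Relation.Unary.Any using (here; there)
open import Data.List.Relation.Unary.Unique.Propositional using (Unique)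
open import Data.List.Relation.Unary.Unique.Propositional.Properties as Unique using (Unique[x∷xs]⇒x∉xs)
open import Data.List.Relation.Binary.Pointwise as Pointwise using (Pointwise; []; _∷_)
open import Function.Properties.Equivalence using () renaming (trans to ⇔-trans)
open import Relation.Binary.Definitions using (tri<; tri≈; tri>)
open import Data.List.Relation.Binary.Equality.Propositional using (≋⇒≡)
open import Data.List.Relation.Unary.AllPairs as AllPairs using (AllPairs; []; _∷_)
open import Data.List.Relation.Unary.Sorted.TotalOrder.Properties using (Sorted⇒AllPairs)
import Data.List.Sort
open Data.List.Sort ≤-decTotalOrder using (sort; sort-↭; sort-↗)
open import Data.Fin as Fin using (Fin; toℕ)
open import Data.Product using (_×_; _,_; ∃; ∃!; proj₁; proj₂)
open import Data.Sum as Sum using (_⊎_; inj₁; inj₂)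
open import Data.Empty using (⊥; ⊥-elim)
open import Data.Unit using (⊤; tt)
open import Function using (_∘_)
open import Function.Bundles using (_⇔_; mk⇔)
open import Relation.Nullary using (¬_; yes; no)
open import Relation.Binary.PropositionalEquality using (_≡_; _≢_; refl; sym; trans; cong; cong₂; subst; subst₂; setoid; module ≡-Reasoning)
open import Data.List.Relation.Binary.Permutation.Setoid.Properties (setoid ℕ) using () renaming (Unique-resp-↭ to Unique-resp-↭ₛ)

-- Duplicate-free lists and sublists

Unique-++⁻ʳ : ∀ (xs : List ℕ) {ys} → Unique (xs ++ ys) → Unique ys
Unique-++⁻ʳ []       u       = u
Unique-++⁻ʳ (x ∷ xs) (_ ∷ u) = Unique-++⁻ʳ xs u

Unique-++-disjoint : ∀ (xs : List ℕ) {ys z} → Unique (xs ++ ys) → z ∈ xs → z ∉ ys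
Unique-++-disjoint (x ∷ xs) u (here refl) z∈ys = Unique[x∷xs]⇒x∉xs u (∈-++⁺ʳ xs z∈ys)
Unique-++-disjoint (x ∷ xs) (_ ∷ u) (there z∈xs) = Unique-++-disjoint xs u z∈xs

Unique-resp-⊇ : ∀ {xs ys : List ℕ} → xs ⊆ ys → Unique ys → Unique xs
Unique-resp-⊇ []         u       = u
Unique-resp-⊇ (y ∷ʳ p)   (_ ∷ u) = Unique-resp-⊇ p u
Unique-resp-⊇ (refl ∷ p) (a ∷ u) = All-resp-⊆ p a ∷ Unique-resp-⊇ p u

Unique-resp-↭ : ∀ {xs ys : List ℕ} → xs ↭ ys → Unique xs → Unique ys
Unique-resp-↭ p = Unique-resp-↭ₛ (↭⇒↭ₛ p)

⊆-from-∈ : ∀ {xs ys zs : List ℕ} → Unique zs → xs ⊆ zs → ys ⊆ zs →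
           (∀ {x} → x ∈ xs → x ∈ ys) → xs ⊆ ys
⊆-from-∈ _ [] _ _ = minimum _
⊆-from-∈ (_ ∷ u) (z ∷ʳ p) (.z ∷ʳ q) h = ⊆-from-∈ u p q h
⊆-from-∈ u@(_ ∷ u′) (z ∷ʳ p) (refl ∷ q) h = z ∷ʳ ⊆-from-∈ u′ p q h′
  where
  h′ : ∀ {x} → x ∈ _ → x ∈ _
  h′ x∈xs with h x∈xs
  ... | here refl  = ⊥-elim (Unique[x∷xs]⇒x∉xs u (Any-resp-⊆ p x∈xs))
  ... | there x∈ys = x∈ys
⊆-from-∈ u (refl ∷ p) (_ ∷ʳ q) h = ⊥-elim (Unique[x∷xs]⇒x∉xs u (Any-resp-⊆ q (h (here refl))))
⊆-from-∈ u@(_ ∷ u′) (refl ∷ p) (refl ∷ q) h = refl ∷ ⊆-from-∈ u′ p q h′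
  where
  h′ : ∀ {x} → x ∈ _ → x ∈ _
  h′ x∈xs with h (there x∈xs)
  ... | here refl  = ⊥-elim (Unique[x∷xs]⇒x∉xs u (Any-resp-⊆ p x∈xs))
  ... | there x∈ys = x∈ys

sublists-↭⇒≡ : ∀ {xs ys zs : List ℕ} → Unique zs → xs ⊆ zs → ys ⊆ zs → xs ↭ ys → xs ≡ ys
sublists-↭⇒≡ u p q xs↭ys =
  ⊆-antisym (⊆-from-∈ u p q (∈-resp-↭ xs↭ys)) (⊆-from-∈ u q p (∈-resp-↭ (↭-sym xs↭ys)))

-- Permutations of 1..n

oneTo-suc : ∀ n → oneTo (suc n) ≡ 1 ∷ map suc (oneTo n)
oneTo-suc n = cong (λ xs → 1 ∷ map suc xs) (sym (map-upTo suc n))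

-- m + 1, …, m + k: the input after m entries have been read
upFrom : ℕ → ℕ → List ℕ
upFrom m zero    = []
upFrom m (suc k) = suc m ∷ upFrom (suc m) k

map-suc-upFrom : ∀ m k → map suc (upFrom m k) ≡ upFrom (suc m) k
map-suc-upFrom m zero    = refl
map-suc-upFrom m (suc k) = cong (suc (suc m) ∷_) (map-suc-upFrom (suc m) k)

oneTo≡upFrom : ∀ n → oneTo n ≡ upFrom 0 n
oneTo≡upFrom zero    = refl
oneTo≡upFrom (suc n) =
  trans (oneTo-suc n) (cong (1 ∷_) (trans (cong (map suc) (oneTo≡upFrom n)) (map-suc-upFrom 0 n)))

Unique-oneTo : ∀ n → Unique (oneTo n)
Unique-oneTo n = Unique.map⁺ suc-injective (Unique.upTo⁺ n)

∈-oneTo⁻ : ∀ {n y} → y ∈ oneTo n → 0 < y × y ≤ n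
∈-oneTo⁻ y∈ with ∈-map⁻ suc y∈
... | i , i∈ , refl = s≤s z≤n , ∈-upTo⁻ i∈

∈-oneTo⁺ : ∀ {n y} → 0 < y → y ≤ n → y ∈ oneTo n
∈-oneTo⁺ {y = suc i} _ i<n = ∈-map⁺ suc (∈-upTo⁺ i<n)

IsPerm⇒Unique : ∀ {π} → IsPerm π → Unique π
IsPerm⇒Unique p = Unique-resp-↭ (↭-sym p) (Unique-oneTo _)

-- Order isomorphism and standardization

SameOrder : ℕ → ℕ → ℕ → ℕ → Set
SameOrder x y a b = ((x < a) ⇔ (y < b)) × ((a < x) ⇔ (b < y))

data OrdIsoᵖ : List ℕ → List ℕ → Set where
  []  : OrdIsoᵖ [] []
  _∷_ : ∀ {x y xs ys} → Pointwise (SameOrder x y) xs ys → OrdIsoᵖ xs ys →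
        OrdIsoᵖ (x ∷ xs) (y ∷ ys)

OrdIso-length : ∀ {xs ys} → OrdIso xs ys → length xs ≡ length ys
OrdIso-length []      = refl
OrdIso-length (_ ∷ o) = cong suc (OrdIso-length o)

Pointwise-lookup : ∀ {R : ℕ → ℕ → Set} {xs ys} → Pointwise R xs ys →
  (i : Fin (length xs)) (j : Fin (length ys)) → toℕ i ≡ toℕ j → R (lookup xs i) (lookup ys j)
Pointwise-lookup (r ∷ _)  Fin.zero    Fin.zero    _ = r
Pointwise-lookup (_ ∷ rs) (Fin.suc i) (Fin.suc j) e = Pointwise-lookup rs i j (suc-injective e)

OrdIso⇒OrdIsoᵖ : ∀ {xs ys} → OrdIso xs ys → OrdIsoᵖ xs ys
OrdIso⇒OrdIsoᵖ []      = []
OrdIso⇒OrdIsoᵖ (h ∷ o) = Pointwise.lookup⁻ (OrdIso-length o) (λ {i} {j} → h i j) ∷ OrdIso⇒OrdIsoᵖ o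

OrdIsoᵖ⇒OrdIso : ∀ {xs ys} → OrdIsoᵖ xs ys → OrdIso xs ys
OrdIsoᵖ⇒OrdIso []      = []
OrdIsoᵖ⇒OrdIso (p ∷ o) = Pointwise-lookup p ∷ OrdIsoᵖ⇒OrdIso o

OrdIsoᵖ-trans : ∀ {xs ys zs} → OrdIsoᵖ xs ys → OrdIsoᵖ ys zs → OrdIsoᵖ xs zs
OrdIsoᵖ-trans []      []        = []
OrdIsoᵖ-trans (p ∷ o) (p′ ∷ o′) =
  Pointwise.transitive (λ (e , f) (e′ , f′) → ⇔-trans e e′ , ⇔-trans f f′) p p′ ∷ OrdIsoᵖ-trans o o′

select : ∀ {g c : List ℕ} → g ⊆ c → List ℕ → List ℕ
select (_ ∷ʳ p) (_ ∷ ys) = select p ys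
select (_ ∷ p)  (y ∷ ys) = y ∷ select p ys
select _        _        = []

select-⊆ : ∀ {g c : List ℕ} (p : g ⊆ c) ys → select p ys ⊆ ys
select-⊆ []       ys       = minimum ys
select-⊆ (_ ∷ʳ p) []       = []
select-⊆ (_ ∷ʳ p) (y ∷ ys) = y ∷ʳ select-⊆ p ys
select-⊆ (_ ∷ p)  []       = []
select-⊆ (_ ∷ p)  (y ∷ ys) = refl ∷ select-⊆ p ys

Pointwise-select : ∀ {R : ℕ → ℕ → Set} {g c ys} → Pointwise R c ys → (p : g ⊆ c) →
                   Pointwise R g (select p ys)
Pointwise-select []       []         = []
Pointwise-select (_ ∷ rs) (_ ∷ʳ p)   = Pointwise-select rs p
Pointwise-select (r ∷ rs) (refl ∷ p) = r ∷ Pointwise-select rs p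

OrdIsoᵖ-select : ∀ {g c ys} → OrdIsoᵖ c ys → (p : g ⊆ c) → OrdIsoᵖ g (select p ys)
OrdIsoᵖ-select []      []         = []
OrdIsoᵖ-select (_ ∷ o) (_ ∷ʳ p)   = OrdIsoᵖ-select o p
OrdIsoᵖ-select (w ∷ o) (refl ∷ p) = Pointwise-select w p ∷ OrdIsoᵖ-select o p

SameOrder-strictMono : ∀ {f : ℕ → ℕ} {x a} → (x < a → f x < f a) → (a < x → f a < f x) →
                       SameOrder x (f x) a (f a)
SameOrder-strictMono {f} mono mono′ = mk⇔ mono (reflect mono′) , mk⇔ mono′ (reflect mono)
  where
  reflect : ∀ {u v} → (v < u → f v < f u) → f u < f v → u < v
  reflect {u} {v} m lt with <-cmp u v
  ... | tri< u<v _ _ = u<v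
  ... | tri≈ _ refl _ = ⊥-elim (<-irrefl refl lt)
  ... | tri> _ _ v<u = ⊥-elim (<-asym lt (m v<u))

OrdIsoᵖ-map : ∀ (f : ℕ → ℕ) g → (∀ {a b} → a ∈ g → b ∈ g → a < b → f a < f b) → OrdIsoᵖ g (map f g)
OrdIsoᵖ-map f []      mono = []
OrdIsoᵖ-map f (x ∷ g) mono =
  pointwise g (All.tabulate λ b∈g →
    SameOrder-strictMono (mono (here refl) (there b∈g)) (mono (there b∈g) (here refl)))
  ∷ OrdIsoᵖ-map f g (λ a∈g b∈g → mono (there a∈g) (there b∈g))
  where
  pointwise : ∀ bs → All (λ b → SameOrder x (f x) b (f b)) bs → Pointwise (SameOrder x (f x)) bs (map f bs)
  pointwise []       []       = []
  pointwise (b ∷ bs) (s ∷ ss) = s ∷ pointwise bs ss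

rank : List ℕ → ℕ → ℕ
rank g y = suc (length (filter (_<? y) g))

standardize : List ℕ → List ℕ
standardize g = map (rank g) g

rank-strictMono : ∀ g {a b} → a ∈ g → a < b → rank g a < rank g b
rank-strictMono g {a} {b} a∈g a<b = s≤s (≤∧≢⇒< (length-mono-≤ below⊆) lengths≢)
  where
  below⊆ : filter (_<? a) g ⊆ filter (_<? b) g
  below⊆ = filter⁺ (_<? a) (_<? b) (λ { refl x<a → <-trans x<a a<b }) (⊆-refl {x = g})
  lengths≢ : length (filter (_<? a) g) ≢ length (filter (_<? b) g)
  lengths≢ e = <-irrefl refl (proj₂ (∈-filter⁻ (_<? a) {xs = g} a∈below))
    where
    a∈below : a ∈ filter (_<? a) g
    a∈below = subst (a ∈_) (sym (≋⇒≡ (to-≋ e below⊆))) (∈-filter⁺ (_<? b) {xs = g} a∈g a<b)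

rank-resp-↭ : ∀ {g h} y → g ↭ h → rank g y ≡ rank h y
rank-resp-↭ y p = cong suc (↭-length (filter-↭ (_<? y) p))

rank-increasing : ∀ s → AllPairs _<_ s → map (rank s) s ≡ oneTo (length s)
rank-increasing []      []            = refl
rank-increasing (a ∷ s) (a<s ∷ inc) = begin
  rank (a ∷ s) a ∷ map (rank (a ∷ s)) s ≡⟨ cong₂ _∷_ rank-min (map-cong-local (All.map rank-above a<s)) ⟩
  1 ∷ map (suc ∘ rank s) s              ≡⟨ cong (1 ∷_) (map-∘ s) ⟩
  1 ∷ map suc (map (rank s) s)          ≡⟨ cong (λ xs → 1 ∷ map suc xs) (rank-increasing s inc) ⟩
  1 ∷ map suc (oneTo (length s))        ≡⟨ sym (oneTo-suc (length s)) ⟩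
  oneTo (length (a ∷ s))                ∎
  where
  open ≡-Reasoning
  rank-min : rank (a ∷ s) a ≡ 1
  rank-min = cong (suc ∘ length) (trans (filter-reject (_<? a) (<-irrefl refl))
                                        (filter-none (_<? a) (All.map <⇒≯ a<s)))
  rank-above : ∀ {y} → a < y → rank (a ∷ s) y ≡ suc (rank s y)
  rank-above a<y = cong (suc ∘ length) (filter-accept (_<? _) a<y)

IsPerm-standardize : ∀ g → Unique g → IsPerm (standardize g)
IsPerm-standardize g u = subst (λ n → standardize g ↭ oneTo n) length≡ (begin
  map (rank g) g ↭⟨ map⁺ (rank g) (↭-sym (sort-↭ g)) ⟩
  map (rank g) s ≡⟨ map-cong-local (All.tabulate λ {y} _ → rank-resp-↭ y (↭-sym (sort-↭ g))) ⟩
  map (rank s) s ≡⟨ rank-increasing s increasing ⟩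
  oneTo (length s) ∎)
  where
  open PermutationReasoning
  s : List ℕ
  s = sort g
  increasing : AllPairs _<_ s
  increasing = AllPairs.zipWith (λ (x≤y , x≢y) → ≤∧≢⇒< x≤y x≢y)
                 (Sorted⇒AllPairs ≤-totalOrder (sort-↗ g) , Unique-resp-↭ (↭-sym (sort-↭ g)) u)
  length≡ : length s ≡ length (standardize g)
  length≡ = trans (↭-length (sort-↭ g)) (sym (length-map (rank g) g))

OrdIsoᵖ-standardize : ∀ g → OrdIsoᵖ g (standardize g)
OrdIsoᵖ-standardize g = OrdIsoᵖ-map (rank g) g (λ a∈g _ → rank-strictMono g a∈g)

-- The witness for g is the standardization of the entries of the witness for c
-- at the positions of g.
Allowed-⊆ : ∀ C {g c} → g ⊆ c → Allowed C c → Allowed C g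
Allowed-⊆ C {g} p (σ , σ∈C , c≅σ) =
  standardize τ , closed C σ (standardize τ) σ∈C (IsPerm-standardize τ τ-unique) τ-contained
  , OrdIsoᵖ⇒OrdIso (OrdIsoᵖ-trans g≅τ (OrdIsoᵖ-standardize τ))
  where
  τ : List ℕ
  τ = select p σ
  g≅τ : OrdIsoᵖ g τ
  g≅τ = OrdIsoᵖ-select (OrdIso⇒OrdIsoᵖ c≅σ) p
  τ-unique : Unique τ
  τ-unique = Unique-resp-⊇ (select-⊆ p σ) (IsPerm⇒Unique (isPerm C σ σ∈C))
  τ-contained : Contains σ (standardize τ)
  τ-contained = τ , select-⊆ p σ , OrdIsoᵖ⇒OrdIso (OrdIsoᵖ-standardize τ)

-- Runs of the machine

insertAt-↭ : ∀ k x c → insertAt k x c ↭ x ∷ c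
insertAt-↭ k x c = ↭-trans (shift x (take k c) (drop k c)) (↭-reflexive (cong (x ∷_) (take++drop≡id k c)))

⊆-insertAt : ∀ k x c → c ⊆ insertAt k x c
⊆-insertAt k x c = subst (_⊆ insertAt k x c) (take++drop≡id k c) (++⁺ ⊆-refl (x ∷ʳ ⊆-refl))

insertAt-injectiveˡ : ∀ {x c} k k′ → x ∉ c → k ≤ length c → k′ ≤ length c →
                      insertAt k x c ≡ insertAt k′ x c → k ≡ k′
insertAt-injectiveˡ zero zero _ _ _ _ = refl
insertAt-injectiveˡ {c = _ ∷ _} zero (suc k′) x∉ _ _ e = ⊥-elim (x∉ (here (∷-injectiveˡ e)))
insertAt-injectiveˡ {c = _ ∷ _} (suc k) zero x∉ _ _ e = ⊥-elim (x∉ (here (sym (∷-injectiveˡ e))))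
insertAt-injectiveˡ {c = _ ∷ _} (suc k) (suc k′) x∉ (s≤s k≤) (s≤s k′≤) e =
  cong suc (insertAt-injectiveˡ k k′ (x∉ ∘ there) k≤ k′≤ (∷-injectiveʳ e))

Run⇒pending : ∀ {C P ops s π} → Run C P ops s (final π) →
              ∃ λ R → π ≡ output s ++ R × container s ⊆ R
Run⇒pending {π = π} done = [] , sym (++-identityʳ π) , []
Run⇒pending (step (bypassStep {x} {_} {_} {out}) _ r) with Run⇒pending r
... | R , e , c⊆R = x ∷ R , trans e (++-assoc out [ x ] R) , x ∷ʳ c⊆R
Run⇒pending (step (pushStep {k} {x} {_} {c} _ _) _ r) with Run⇒pending r
... | R , e , c⊆R = R , e , ⊆-trans (⊆-insertAt k x c) c⊆R
Run⇒pending (step (popStep {x} {_} {_} {out}) _ r) with Run⇒pending r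
... | R , e , c⊆R = x ∷ R , trans e (++-assoc out [ x ] R) , refl ∷ c⊆R

Run⇒next : ∀ {C P ops π inp c out a} → Run C P ops ⟨ inp , c , out ++ [ a ] ⟩ (final π) →
           ∃ λ R → π ≡ out ++ a ∷ R × c ⊆ R
Run⇒next {out = out} {a} r with Run⇒pending r
... | R , e , c⊆R = R , trans e (++-assoc out [ a ] R) , c⊆R

record Read (m : ℕ) (s : State) : Set where
  field
    unread     : ∃ λ k → input s ≡ upFrom m k
    output≤    : All (_≤ m) (output s)
    container≤ : All (_≤ m) (container s)
    covered    : ∀ {y} → 0 < y → y ≤ m → y ∈ output s ⊎ y ∈ container s
open Read

read-head : ∀ {m x inp} → (∃ λ k → x ∷ inp ≡ upFrom m k) → x ≡ suc m × ∃ λ k → inp ≡ upFrom (suc m) k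
read-head (zero  , ())
read-head (suc k , refl) = refl , k , refl

Read-initial : ∀ π → Read 0 (initial π)
Read-initial π = record
  { unread = length π , oneTo≡upFrom (length π) ; output≤ = [] ; container≤ = []
  ; covered = λ { (s≤s _) () } }

Read-pop : ∀ {m inp x c out} → Read m ⟨ inp , x ∷ c , out ⟩ → Read m ⟨ inp , c , out ++ [ x ] ⟩
Read-pop {out = out} F = record
  { unread = unread F
  ; output≤ = AllP.++⁺ (output≤ F) (All.head (container≤ F) ∷ [])
  ; container≤ = All.tail (container≤ F)
  ; covered = λ 0<y y≤m → moved (covered F 0<y y≤m) }
  where
  moved : ∀ {y} → y ∈ out ⊎ y ∈ _ ∷ _ → y ∈ out ++ [ _ ] ⊎ y ∈ _
  moved (inj₁ y∈out)        = inj₁ (∈-++⁺ˡ y∈out)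
  moved (inj₂ (here refl))  = inj₁ (∈-++⁺ʳ out (here refl))
  moved (inj₂ (there y∈c))  = inj₂ y∈c

Read-bypass : ∀ {m x inp c out} → Read m ⟨ x ∷ inp , c , out ⟩ → Read (suc m) ⟨ inp , c , out ++ [ x ] ⟩
Read-bypass {m} {out = out} F with read-head (unread F)
... | refl , rest = record
  { unread = rest
  ; output≤ = AllP.++⁺ (All.map m≤n⇒m≤1+n (output≤ F)) (≤-refl ∷ [])
  ; container≤ = All.map m≤n⇒m≤1+n (container≤ F)
  ; covered = covered′ }
  where
  covered′ : ∀ {y} → 0 < y → y ≤ suc m → y ∈ out ++ [ suc m ] ⊎ y ∈ _
  covered′ 0<y y≤ with m≤n⇒m<n∨m≡n y≤
  ... | inj₂ refl = inj₁ (∈-++⁺ʳ out (here refl))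
  ... | inj₁ y<   = Sum.map₁ ∈-++⁺ˡ (covered F 0<y (≤-pred y<))

Read-push : ∀ {m x inp c out k} → Read m ⟨ x ∷ inp , c , out ⟩ → Read (suc m) ⟨ inp , insertAt k x c , out ⟩
Read-push {m} {c = c} {k = k} F with read-head (unread F)
... | refl , rest = record
  { unread = rest
  ; output≤ = All.map m≤n⇒m≤1+n (output≤ F)
  ; container≤ = All-resp-↭ (↭-sym (insertAt-↭ k (suc m) c)) (≤-refl ∷ All.map m≤n⇒m≤1+n (container≤ F))
  ; covered = covered′ }
  where
  covered′ : ∀ {y} → 0 < y → y ≤ suc m → y ∈ _ ⊎ y ∈ insertAt k (suc m) c
  covered′ 0<y y≤ with m≤n⇒m<n∨m≡n y≤
  ... | inj₂ refl = inj₂ (∈-resp-↭ (↭-sym (insertAt-↭ k (suc m) c)) (here refl))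
  ... | inj₁ y<   = Sum.map₂ (∈-resp-↭ (↭-sym (insertAt-↭ k (suc m) c)) ∘ there) (covered F 0<y (≤-pred y<))

Read⇒output< : ∀ {m x inp c out} → Read m ⟨ x ∷ inp , c , out ⟩ → All (_< x) out
Read⇒output< F with read-head (unread F)
... | refl , _ = All.map s≤s (output≤ F)

-- Positions in π and the rules (U1), (U2)

index-after : ∀ {π : List ℕ} out {x R} → π ≡ out ++ x ∷ R →
              ∃ λ (j : Fin (length π)) → toℕ j ≡ length out × lookup π j ≡ x
index-after []      refl = Fin.zero , refl , refl
index-after (_ ∷ out) refl with index-after out refl
... | j , j≡ , look = Fin.suc j , cong suc j≡ , look

lookup-after : ∀ {π : List ℕ} out {x R} → π ≡ out ++ x ∷ R →
               (j : Fin (length π)) → toℕ j ≡ length out → lookup π j ≡ x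
lookup-after []        refl Fin.zero    _ = refl
lookup-after (_ ∷ out) refl (Fin.suc j) e = lookup-after out refl j (suc-injective e)

lookup-before : ∀ {π : List ℕ} out {R} → π ≡ out ++ R →
                (i : Fin (length π)) → toℕ i < length out → lookup π i ∈ out
lookup-before (_ ∷ out) refl Fin.zero    _         = here refl
lookup-before (_ ∷ out) refl (Fin.suc i) (s≤s i<) = there (lookup-before out refl i i<)

index-before : ∀ {π : List ℕ} out {R z} → π ≡ out ++ R → z ∈ out →
               ∃ λ (i : Fin (length π)) → toℕ i < length out × lookup π i ≡ z
index-before (_ ∷ out) refl (here refl) = Fin.zero , s≤s z≤n , refl
index-before (_ ∷ out) refl (there z∈) with index-before out refl z∈
... | i , i< , look = Fin.suc i , s≤s i< , look

LRMaxAt-after : ∀ {π : List ℕ} out {x R} → π ≡ out ++ x ∷ R → All (_< x) out →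
                (j : Fin (length π)) → toℕ j ≡ length out → LRMaxAt π j
LRMaxAt-after {π} out e below j j≡ i i<j =
  subst (lookup π i <_) (sym (lookup-after out e j j≡))
        (All.lookup below (lookup-before out e i (subst (toℕ i <_) j≡ i<j)))

¬LRMaxAt-after : ∀ {π : List ℕ} out {x R z} → π ≡ out ++ x ∷ R → z ∈ out → x < z →
                 (j : Fin (length π)) → toℕ j ≡ length out → ¬ LRMaxAt π j
¬LRMaxAt-after out e z∈ x<z j j≡ lrmax with index-before out e z∈
... | i , i< , look =
  <-asym x<z (subst₂ _<_ look (lookup-after out e j j≡) (lrmax i (subst (toℕ i <_) (sym j≡) i<)))

U1⇒pop : ∀ {π op inp x c out R} → U1 π op ⟨ inp , x ∷ c , out ⟩ → π ≡ out ++ x ∷ R → op ≡ pop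
U1⇒pop {out = out} u1 e with index-after out e
... | j , j≡ , look = u1 j _ _ j≡ refl look

U1-vacuous : ∀ {π op inp c out y R} → y ∉ c → π ≡ out ++ y ∷ R → U1 π op ⟨ inp , c , out ⟩
U1-vacuous {out = out} y∉c e j x c′ j≡ refl look =
  ⊥-elim (y∉c (here (trans (sym (lookup-after out e j j≡)) look)))

-- (U1) forces a pop, which (U2) forbids.
LRMax-stuck : ∀ {C π ops inp x c out R} → Run C (U1U2 π) ops ⟨ inp , x ∷ c , out ⟩ (final π) →
              π ≡ out ++ x ∷ R → All (_< x) out → ⊥
LRMax-stuck {inp = inp} {out = out} (step _ (u1 , u2) _) e below with U1⇒pop {inp = inp} u1 e | index-after out e
... | refl | j , j≡ , _ with u2 j j≡ (LRMaxAt-after out e below j j≡) (inj₂ refl)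
... | ()

pop-forced : ∀ {C P π op ops s s′} → Step C pop s s′ → Run C P ops s′ (final π) → U1 π op s → op ≡ pop
pop-forced (popStep {inp = inp}) r u1 = U1⇒pop {inp = inp} u1 (proj₁ (proj₂ (Run⇒next r)))

-- Uniqueness

module _ {C : PermClass} {π : List ℕ} (π-unique : Unique π) where

  push-positions-agree : ∀ {P Q ops₁ ops₂ inp x c out k k′} → k ≤ length c → k′ ≤ length c →
    Run C P ops₁ ⟨ inp , insertAt k x c , out ⟩ (final π) →
    Run C Q ops₂ ⟨ inp , insertAt k′ x c , out ⟩ (final π) → k ≡ k′
  push-positions-agree {x = x} {c} {out} {k} {k′} k≤ k′≤ r₁ r₂ with Run⇒pending r₁ | Run⇒pending r₂
  ... | R , e₁ , ins⊆R | R′ , e₂ , ins′⊆R′ = insertAt-injectiveˡ k k′ x∉c k≤ k′≤ ins≡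
    where
    R-unique : Unique R
    R-unique = Unique-++⁻ʳ out (subst Unique e₁ π-unique)
    ins′⊆R : insertAt k′ x c ⊆ R
    ins′⊆R = subst (insertAt k′ x c ⊆_) (++-cancelˡ out R′ R (trans (sym e₂) e₁)) ins′⊆R′
    ins≡ : insertAt k x c ≡ insertAt k′ x c
    ins≡ = sublists-↭⇒≡ R-unique ins⊆R ins′⊆R (↭-trans (insertAt-↭ k x c) (↭-sym (insertAt-↭ k′ x c)))
    x∉c : x ∉ c
    x∉c = Unique[x∷xs]⇒x∉xs (Unique-resp-↭ (insertAt-↭ k x c) (Unique-resp-⊇ ins⊆R R-unique))

  -- Had the next input x been pushed rather than bypassed, it would sit at the
  -- front of the container while being a left-to-right maximum.
  bypass-push-exclusive : ∀ {P ops₁ ops₂ inp x c out k} → All (_< x) out →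
    Run C P ops₁ ⟨ inp , c , out ++ [ x ] ⟩ (final π) →
    Run C (U1U2 π) ops₂ ⟨ inp , insertAt k x c , out ⟩ (final π) → ⊥
  bypass-push-exclusive {ops₂ = ops₂} {inp} {x} {c} {out} {k} below r₁ r₂ with Run⇒next r₁ | Run⇒pending r₂
  ... | R , e , c⊆R | R′ , e′ , ins⊆R′ =
    LRMax-stuck (subst (λ c′ → Run C (U1U2 π) ops₂ ⟨ inp , c′ , out ⟩ (final π)) ins≡ r₂) e below
    where
    xR-unique : Unique (x ∷ R)
    xR-unique = Unique-++⁻ʳ out (subst Unique e π-unique)
    ins⊆xR : insertAt k x c ⊆ x ∷ R
    ins⊆xR = subst (insertAt k x c ⊆_) (++-cancelˡ out R′ (x ∷ R) (trans (sym e′) e)) ins⊆R′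
    ins≡ : insertAt k x c ≡ x ∷ c
    ins≡ = sublists-↭⇒≡ xR-unique ins⊆xR (refl ∷ c⊆R) (insertAt-↭ k x c)

  good-runs-agree : ∀ {m s ops₁ ops₂} → Read m s →
    Run C (U1U2 π) ops₁ s (final π) → Run C (U1U2 π) ops₂ s (final π) → ops₁ ≡ ops₂
  good-runs-agree F done done = refl
  good-runs-agree F (step bypassStep _ r₁) (step bypassStep _ r₂) =
    cong (bypass ∷_) (good-runs-agree (Read-bypass F) r₁ r₂)
  good-runs-agree F (step popStep _ r₁) (step popStep _ r₂) =
    cong (pop ∷_) (good-runs-agree (Read-pop F) r₁ r₂)
  good-runs-agree F (step (pushStep k≤ _) _ r₁) (step (pushStep k′≤ _) _ r₂)
    with push-positions-agree k≤ k′≤ r₁ r₂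
  ... | refl = cong (push _ ∷_) (good-runs-agree (Read-push F) r₁ r₂)
  good-runs-agree F (step bypassStep _ r₁) (step (pushStep _ _) _ r₂) =
    ⊥-elim (bypass-push-exclusive (Read⇒output< F) r₁ r₂)
  good-runs-agree F (step (pushStep _ _) _ r₁) (step bypassStep _ r₂) =
    ⊥-elim (bypass-push-exclusive (Read⇒output< F) r₂ r₁)
  good-runs-agree F (step st@popStep _ r₁) (step bypassStep (u1 , _) _) with pop-forced st r₁ u1
  ... | ()
  good-runs-agree F (step st@popStep _ r₁) (step (pushStep _ _) (u1 , _) _) with pop-forced st r₁ u1
  ... | ()
  good-runs-agree F (step bypassStep (u1 , _) _) (step st@popStep _ r₂) with pop-forced st r₂ u1
  ... | ()
  good-runs-agree F (step (pushStep _ _) (u1 , _) _) (step st@popStep _ r₂) with pop-forced st r₂ u1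
  ... | ()

-- Existence

filter-≤-suc : ∀ {m} xs → suc m ∉ xs → filter (_≤? m) xs ≡ filter (_≤? suc m) xs
filter-≤-suc []       _   = refl
filter-≤-suc {m} (z ∷ xs) sm∉ with z ≤? m
... | yes z≤m rewrite filter-accept (_≤? m) {xs = xs} z≤m
                    | filter-accept (_≤? suc m) {xs = xs} (m≤n⇒m≤1+n z≤m) =
  cong (z ∷_) (filter-≤-suc xs (sm∉ ∘ there))
... | no  z≰m rewrite filter-reject (_≤? m) {xs = xs} z≰m
                    | filter-reject (_≤? suc m) {xs = xs} (sm∉ ∘ here ∘ ≤-antisym (≰⇒> z≰m)) =
  filter-≤-suc xs (sm∉ ∘ there)

filter-≤-insert : ∀ {m} xs → Unique xs → suc m ∈ xs →
  ∃ λ j → j ≤ length (filter (_≤? m) xs) × insertAt j (suc m) (filter (_≤? m) xs) ≡ filter (_≤? suc m) xs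
filter-≤-insert {m} (_ ∷ xs) u (here refl)
  rewrite filter-reject (_≤? m) {xs = xs} (<-irrefl refl ∘ s≤s)
        | filter-accept (_≤? suc m) {xs = xs} ≤-refl =
  0 , z≤n , cong (suc m ∷_) (filter-≤-suc xs (Unique[x∷xs]⇒x∉xs u))
filter-≤-insert {m} (z ∷ xs) (z≢ ∷ u) (there sm∈) with filter-≤-insert xs u sm∈ | z ≤? m
... | j , j≤ , ins≡ | yes z≤m rewrite filter-accept (_≤? m) {xs = xs} z≤m
                                    | filter-accept (_≤? suc m) {xs = xs} (m≤n⇒m≤1+n z≤m) =
  suc j , s≤s j≤ , cong (z ∷_) ins≡
... | j , j≤ , ins≡ | no  z≰m rewrite filter-reject (_≤? m) {xs = xs} z≰m
                                    | filter-reject (_≤? suc m) {xs = xs}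
                                        (All.lookup z≢ sm∈ ∘ sym ∘ ≤-antisym (≰⇒> z≰m)) =
  j , j≤ , ins≡

bounded-prefix : ∀ {m} A {a X} B {Y} → A ++ a ∷ X ≡ B ++ Y → All (_≤ m) A → All (_≤ m) B → m < a →
                 ∃ λ D → All (_≤ m) D × Y ≡ D ++ a ∷ X
bounded-prefix A        []      e A≤ _          _   = A , A≤ , sym e
bounded-prefix []       (b ∷ B) e _  (b≤ ∷ _)   m<a = ⊥-elim (<⇒≱ m<a (subst (_≤ _) (sym (∷-injectiveˡ e)) b≤))
bounded-prefix (_ ∷ A)  (_ ∷ B) e (_ ∷ A≤) (_ ∷ B≤) m<a = bounded-prefix A B (∷-injectiveʳ e) A≤ B≤ m<a

-- Guarantees that an entry popped by the canonical run is not a left-to-right maximum.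
Settled : ℕ → List ℕ → List ℕ → Set
Settled m out []      = ⊤
Settled m out (y ∷ _) = m ∈ out ⊎ m < y

Settled-output : ∀ {m out} rest → m ∈ out → Settled m out rest
Settled-output []      _     = tt
Settled-output (_ ∷ _) m∈out = inj₁ m∈out

module _ {C : PermClass} {π : List ℕ} (π-perm : IsPerm π) where

  private
    π-unique : Unique π
    π-unique = IsPerm⇒Unique π-perm

    ∈π⇒positive : ∀ {y} → y ∈ π → 0 < y
    ∈π⇒positive = proj₁ ∘ ∈-oneTo⁻ ∘ ∈-resp-↭ π-perm

    suffix-unique : ∀ out {R} → π ≡ out ++ R → Unique R
    suffix-unique out eπ = Unique-++⁻ʳ out (subst Unique eπ π-unique)

    ∈π⇒≤length : ∀ {y} → y ∈ π → y ≤ length π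
    ∈π⇒≤length = proj₂ ∘ ∈-oneTo⁻ ∘ ∈-resp-↭ π-perm

    entry-bound : ∀ {out y rest} → π ≡ out ++ y ∷ rest → y ≤ length π
    entry-bound {out} eπ = ∈π⇒≤length (subst (_ ∈_) (sym eπ) (∈-++⁺ʳ out (here refl)))

    below-entry : ∀ {out y rest m} → π ≡ out ++ y ∷ rest → m < y → suc m ∈ oneTo (length π)
    below-entry eπ m<y = ∈-oneTo⁺ (s≤s z≤n) (≤-trans m<y (entry-bound eπ))

    unread-in-suffix : ∀ {m z} out {R} → π ≡ out ++ R → All (_≤ m) out → z ∈ oneTo (length π) → m < z → z ∈ R
    unread-in-suffix out eπ out≤ z∈ m<z with ∈-++⁻ out (subst (_ ∈_) eπ (∈-resp-↭ (↭-sym π-perm) z∈))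
    ... | inj₁ z∈out = ⊥-elim (<⇒≱ m<z (All.lookup out≤ z∈out))
    ... | inj₂ z∈R   = z∈R

  bypass-too-early : ∀ {P ops m inp c out₀ out y rest} → All (_≤ m) out₀ →
    Run C P ops ⟨ inp , c , out₀ ++ [ suc m ] ⟩ (final π) →
    π ≡ out ++ y ∷ rest → All (_≤ m) out → suc m < y → ⊥
  bypass-too-early out₀≤ r eπ out≤ sm<y with Run⇒next r
  ... | R , e , _ with bounded-prefix _ _ (trans (sym eπ) e) out≤ out₀≤ (<-trans (n<1+n _) sm<y)
  ... | []    , _        , refl = <-irrefl refl sm<y
  ... | _ ∷ _ , (d≤ ∷ _) , refl = <-irrefl refl d≤

  -- At the moment m + 1 is pushed, the container holds every entry ≤ m + 1 still
  -- to be output, in order; the canonical run needs a sublist of these.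
  allowed-after-push : ∀ {P ops m inp k c out₀ out y rest} → Read m ⟨ suc m ∷ inp , c , out₀ ⟩ →
    Allowed C (insertAt k (suc m) c) →
    Run C P ops ⟨ inp , insertAt k (suc m) c , out₀ ⟩ (final π) →
    π ≡ out ++ y ∷ rest → All (_≤ m) out → suc m < y →
    Allowed C (filter (_≤? suc m) (y ∷ rest))
  allowed-after-push {m = m} {k = k} {c} {out₀} {y = y} {rest} F allowed r eπ out≤ sm<y
    with Run⇒pending r
  ... | R , e , c′⊆R with bounded-prefix _ _ (trans (sym eπ) e) out≤ (output≤ F) (<-trans (n<1+n m) sm<y)
  ... | D , _ , R≡ = Allowed-⊆ C (⊆-from-∈ R-unique G⊆R c′⊆R into-container) allowed
    where
    G : List ℕ
    G = filter (_≤? suc m) (y ∷ rest)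
    out₀R-unique : Unique (out₀ ++ R)
    out₀R-unique = subst Unique e π-unique
    R-unique : Unique R
    R-unique = Unique-++⁻ʳ out₀ out₀R-unique
    rest⊆R : y ∷ rest ⊆ R
    rest⊆R = subst (y ∷ rest ⊆_) (sym R≡) (++⁺ˡ D ⊆-refl)
    G⊆R : G ⊆ R
    G⊆R = ⊆-trans (filter-⊆ (_≤? suc m) (y ∷ rest)) rest⊆R
    into-container : ∀ {z} → z ∈ G → z ∈ insertAt k (suc m) c
    into-container z∈G with ∈-filter⁻ (_≤? suc m) {xs = y ∷ rest} z∈G
    ... | z∈rest , z≤ with Any-resp-⊆ rest⊆R z∈rest
    ... | z∈R with covered (Read-push F) (∈π⇒positive (subst (_ ∈_) (sym e) (∈-++⁺ʳ out₀ z∈R))) z≤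
    ... | inj₁ z∈out₀ = ⊥-elim (Unique-++-disjoint out₀ out₀R-unique z∈out₀ z∈R)
    ... | inj₂ z∈c′   = z∈c′

  allowed-when-read : ∀ {P ops s m₀ m out y rest} → Run C P ops s (final π) → Read m₀ s →
    suc m ∈ input s → π ≡ out ++ y ∷ rest → All (_≤ m) out → suc m < y →
    Allowed C (filter (_≤? suc m) (y ∷ rest))
  allowed-when-read (step popStep _ r) F sm∈ = allowed-when-read r (Read-pop F) sm∈
  allowed-when-read (step bypassStep _ r) F (there sm∈) = allowed-when-read r (Read-bypass F) sm∈
  allowed-when-read (step (pushStep _ _) _ r) F (there sm∈) = allowed-when-read r (Read-push F) sm∈
  allowed-when-read (step bypassStep _ r) F (here refl) eπ out≤ sm<y with read-head (unread F)
  ... | refl , _ = ⊥-elim (bypass-too-early (output≤ F) r eπ out≤ sm<y)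
  allowed-when-read (step (pushStep _ allowed) _ r) F (here refl) with read-head (unread F)
  ... | refl , _ = allowed-after-push F allowed r

  GoodRunFrom : State → Set
  GoodRunFrom s = ∃ λ ops → Run C (U1U2 π) ops s (final π)

  canonical-pop : ∀ {m inp out y rest} → y < m → m ∈ out → π ≡ out ++ y ∷ rest →
    GoodRunFrom ⟨ inp , filter (_≤? m) rest , out ++ [ y ] ⟩ →
    GoodRunFrom ⟨ inp , filter (_≤? m) (y ∷ rest) , out ⟩
  canonical-pop {m} {inp} {out} {y} {rest} y<m m∈out eπ (ops , r)
    rewrite filter-accept (_≤? m) {xs = rest} (<⇒≤ y<m) =
    pop ∷ ops , step popStep ((λ _ _ _ _ _ _ → refl) , u2) r
    where
    u2 : U2 π pop ⟨ inp , y ∷ filter (_≤? m) rest , out ⟩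
    u2 j j≡ lrmax _ = ⊥-elim (¬LRMaxAt-after out eπ m∈out y<m j j≡ lrmax)

  canonical-bypass : ∀ {m k out rest} → π ≡ out ++ suc m ∷ rest →
    GoodRunFrom ⟨ upFrom (suc m) k , filter (_≤? suc m) rest , out ++ [ suc m ] ⟩ →
    GoodRunFrom ⟨ upFrom m (suc k) , filter (_≤? m) (suc m ∷ rest) , out ⟩
  canonical-bypass {m} {k} {out} {rest} eπ (ops , r)
    rewrite filter-reject (_≤? m) {xs = rest} (<-irrefl refl ∘ s≤s)
          | filter-≤-suc rest (Unique[x∷xs]⇒x∉xs (suffix-unique out eπ)) =
    bypass ∷ ops , step bypassStep (U1-vacuous {inp = upFrom m (suc k)} sm∉c eπ , λ _ _ _ _ → refl) r
    where
    sm∉c : suc m ∉ filter (_≤? suc m) rest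
    sm∉c = Unique[x∷xs]⇒x∉xs (suffix-unique out eπ) ∘ proj₁ ∘ ∈-filter⁻ (_≤? suc m) {xs = rest}

  canonical-push : ∀ {m k out y rest} → π ≡ out ++ y ∷ rest → All (_≤ m) out → suc m < y →
    Allowed C (filter (_≤? suc m) (y ∷ rest)) →
    GoodRunFrom ⟨ upFrom (suc m) k , filter (_≤? suc m) (y ∷ rest) , out ⟩ →
    GoodRunFrom ⟨ upFrom m (suc k) , filter (_≤? m) (y ∷ rest) , out ⟩
  canonical-push {m} {k} {out} {y} {rest} eπ out≤ sm<y allowed (ops , r)
    with filter-≤-insert (y ∷ rest) (suffix-unique out eπ)
           (unread-in-suffix out eπ out≤ (below-entry eπ (<-trans (n<1+n m) sm<y)) (n<1+n m))
  ... | j , j≤ , ins≡ =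
    push j ∷ ops ,
    step (pushStep j≤ (subst (Allowed C) (sym ins≡) allowed)) (U1-vacuous {inp = upFrom m (suc k)} y∉c eπ , u2)
         (subst (λ c → Run C (U1U2 π) ops ⟨ upFrom (suc m) k , c , out ⟩ (final π)) (sym ins≡) r)
    where
    y∉c : y ∉ filter (_≤? m) (y ∷ rest)
    y∉c y∈ = <⇒≱ (<-trans (n<1+n m) sm<y) (proj₂ (∈-filter⁻ (_≤? m) {xs = y ∷ rest} y∈))
    u2 : U2 π (push j) ⟨ upFrom m (suc k) , filter (_≤? m) (y ∷ rest) , out ⟩
    u2 _ _ _ (inj₁ ())
    u2 _ _ _ (inj₂ ())

  popped-below : ∀ {m out y rest} → π ≡ out ++ y ∷ rest → y ≤ m → Settled m out (y ∷ rest) → y < m × m ∈ out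
  popped-below _  y≤m (inj₂ m<y) = ⊥-elim (<⇒≱ m<y y≤m)
  popped-below {out = out} eπ y≤m (inj₁ m∈out) =
    ≤∧≢⇒< y≤m (λ { refl → Unique-++-disjoint out (subst Unique eπ π-unique) m∈out (here refl) }) , m∈out

  entry-beyond : ∀ {m out y rest} → m + 0 ≡ length π → π ≡ out ++ y ∷ rest → y < suc m
  entry-beyond {m} sm eπ = s≤s (subst (_ ≤_) (trans (sym sm) (+-identityʳ m)) (entry-bound eπ))

  module _ {ops₀ : List Op} (run₀ : GenSeq C π ops₀) where

    canonical-allowed : ∀ {m out y rest} → π ≡ out ++ y ∷ rest → All (_≤ m) out → suc m < y →
                        Allowed C (filter (_≤? suc m) (y ∷ rest))
    canonical-allowed eπ out≤ sm<y =
      allowed-when-read run₀ (Read-initial π) (below-entry eπ (<-trans (n<1+n _) sm<y)) eπ out≤ sm<y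

    canonical-run : ∀ m k out rest → m + k ≡ length π → π ≡ out ++ rest → All (_≤ m) out →
      Settled m out rest → GoodRunFrom ⟨ upFrom m k , filter (_≤? m) rest , out ⟩
    canonical-run m zero out [] _ eπ _ _ =
      [] , subst (λ o → Run C (U1U2 π) [] ⟨ [] , [] , o ⟩ (final π)) (trans eπ (++-identityʳ out)) done
    canonical-run m (suc k) out [] sm eπ out≤ _
      with unread-in-suffix out eπ out≤
             (∈-oneTo⁺ (s≤s z≤n) (subst (suc m ≤_) sm (m<m+n m (s≤s z≤n)))) (n<1+n m)
    ... | ()
    canonical-run m k out (y ∷ rest) sm eπ out≤ settled with <-cmp y (suc m)
    canonical-run m k out (y ∷ rest) sm eπ out≤ settled | tri< y<sm _ _ with popped-below eπ (≤-pred y<sm) settled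
    ... | y<m , m∈out =
      canonical-pop y<m m∈out eπ (canonical-run m k (out ++ [ y ]) rest sm
        (trans eπ (sym (++-assoc out [ y ] rest))) (AllP.++⁺ out≤ (<⇒≤ y<m ∷ []))
        (Settled-output rest (∈-++⁺ˡ m∈out)))
    canonical-run m zero out (y ∷ rest) sm eπ _ _ | tri≈ _ refl _ = ⊥-elim (<-irrefl refl (entry-beyond sm eπ))
    canonical-run m zero out (y ∷ rest) sm eπ _ _ | tri> _ _ sm<y = ⊥-elim (<-asym sm<y (entry-beyond sm eπ))
    canonical-run m (suc k) out (_ ∷ rest) sm eπ out≤ _ | tri≈ _ refl _ =
      canonical-bypass eπ (canonical-run (suc m) k (out ++ [ suc m ]) rest (trans (sym (+-suc m k)) sm)
        (trans eπ (sym (++-assoc out [ suc m ] rest))) (AllP.++⁺ (All.map m≤n⇒m≤1+n out≤) (≤-refl ∷ []))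
        (Settled-output rest (∈-++⁺ʳ out (here refl))))
    canonical-run m (suc k) out (y ∷ rest) sm eπ out≤ _ | tri> _ _ sm<y =
      canonical-push eπ out≤ sm<y (canonical-allowed eπ out≤ sm<y)
        (canonical-run (suc m) k out (y ∷ rest) (trans (sym (+-suc m k)) sm) eπ
          (All.map m≤n⇒m≤1+n out≤) (inj₂ sm<y))

    canonical-generation : ∃ (GoodGenSeq C π)
    canonical-generation =
      subst₂ (λ i c → GoodRunFrom ⟨ i , c , [] ⟩) (sym (oneTo≡upFrom (length π))) nothing-read
        (canonical-run 0 (length π) [] π refl refl [] (Settled-initial π (All.tabulate ∈π⇒positive)))
      where
      nothing-read : filter (_≤? 0) π ≡ []
      nothing-read = filter-none (_≤? 0) (All.tabulate λ y∈π → <⇒≱ (∈π⇒positive y∈π))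
      Settled-initial : ∀ rest → All (0 <_) rest → Settled 0 [] rest
      Settled-initial []      _       = tt
      Settled-initial (_ ∷ _) (p ∷ _) = inj₂ p

proposition2p1 : (C : PermClass) (π : List ℕ) → IsPerm π → Generable C π →
    ∃! _≡_ (λ ops → GoodGenSeq C π ops)
proposition2p1 C π π-perm (_ , run₀) with canonical-generation π-perm run₀
... | ops , good = ops , good , good-runs-agree (IsPerm⇒Unique π-perm) (Read-initial π) good
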